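{- Let $\mathcal{L}$ be an intuitionistically compact abstract intuitionistic logic with $\mathsf{IL}\trianglelefteq\mathcal{L}$, and suppose $\mathsf{IL}\not\equiv\mathcal{L}$. Then there exist a formula $\phi\in L(\Theta_\phi)$, where $\Theta_\phi$ is the finite occurrence vocabulary of $\phi$, and pointed $\Theta_\phi$-models $(\mathcal{M}_1,w_1)$, $(\mathcal{M}_2,w_2)$ such that $Th^+_{IL}(\mathcal{M}_1,w_1)\subseteq Th^+_{IL}(\mathcal{M}_2,w_2)$, $\mathcal{M}_1,w_1\models_\mathcal{L}\phi$ and $\mathcal{M}_2,w_2\not\models_\mathcal{L}\phi$.
   Context: A $\Theta$-model $\mathcal{M}=\langle W,R,V\rangle$: $W$ nonempty, $R$ a preorder, $V:\Theta\to2^W$ upward closed along $R$; $\models_{IL}$ is standard intuitionistic Kripke satisfaction for formulas over $\bot,\top,\wedge,\vee,\to$; $Th^+_{IL}(\mathcal{M},w)$ is the set of intuitionistic formulas true at $w$. An abstract intuitionistic logic $\mathcal{L}=(L,\models_\mathcal{L})$ assigns to each vocabulary $\Theta$ a set $L(\Theta)$ with a satisfaction relation on pointed models such that: $L$ is monotone in $\Theta$; formulas satisfied in $\Theta$-models lie in $L(\Theta)$; isomorphism invariance; (Expansion) for $\phi\in L(\Theta)$, $\Theta\subseteq\Theta'$, truth of $\phi$ in a $\Theta'$-model equals truth in its $\Theta$-reduct; (Occurrence) each $\phi\in L(\Theta)$ has a finite $\Theta_\phi\subseteq\Theta$ such that $\models_\mathcal{L}\phi$ is defined on $\Theta'$-models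 iff $\Theta_\phi\subseteq\Theta'$; (Closure) closed under $\to,\wedge,\vee$. $\mathcal{L}\trianglelefteq\mathcal{L}'$: each formula of $\mathcal{L}$ has an equivalent (same pointed models) formula of $\mathcal{L}'$ in the same vocabulary; $\equiv$ means both directions. $\mathsf{IL}\trianglelefteq\mathcal{L}$ is taken to mean $IL(\Theta)\subseteq L(\Theta)$ with usual meaning. An $L(\Theta)$-theory $(\Gamma,\Delta)$ is $\mathcal{L}$-satisfiable if some pointed model makes all of $\Gamma$ true and all of $\Delta$ false; $\mathcal{L}$ is intuitionistically compact if every theory all of whose finite subtheories (finite $\Gamma'\subseteq\Gamma$, $\Delta'\subseteq\Delta$) are satisfiable is satisfiable. -}

module Defs where

open import Level using (Level; 0ℓ) renaming (suc to lsuc)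
open import Data.Bool using (Bool; T)
open import Data.List using (List)
open import Data.List.Membership.Propositional using (_∈_)
open import Data.List.Relation.Unary.All using (All)
open import Data.Product using (Σ; Σ-syntax; ∃; _×_; _,_)
open import Data.Empty using (⊥)
open import Data.Unit using (⊤)
open import Function.Bundles using (_⇔_; _↔_; Inverse)
open import Data.Sum using (_⊎_)
open import Relation.Nullary using (¬_)

-- Vocabularies: subsets of a fixed type A of propositional letters,
-- given by characteristic functions (so membership proofs are unique).

Voc : Set → Set
Voc A = A → Bool

_∈ᵥ_ : {A : Set} → A → Voc A → Set
p ∈ᵥ Θ = T (Θ p)

_⊆ᵥ_ : {A : Set} → Voc A → Voc A → Set
Θ ⊆ᵥ Θ' = ∀ p → p ∈ᵥ Θ → p ∈ᵥ Θ'

Finite : {A : Set} → Voc A → Set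
Finite {A} Θ = Σ (List A) λ xs → ∀ p → (p ∈ᵥ Θ) ⇔ (p ∈ xs)

-- Θ-models: W a set, R a preorder, V upward closed along R.
-- (Nonemptiness of W is automatic for the pointed models used below.)

record Model {A : Set} (Θ : Voc A) : Set₁ where
  field
    W       : Set
    R       : W → W → Set
    R-refl  : ∀ w → R w w
    R-trans : ∀ {u v w} → R u v → R v w → R u w
    V       : (p : A) → p ∈ᵥ Θ → W → Set
    V-mono  : ∀ p (h : p ∈ᵥ Θ) {u v} → R u v → V p h u → V p h v
open Model public

reduct : {A : Set} {Θ Θ' : Voc A} → Θ ⊆ᵥ Θ' → Model Θ' → Model Θ
reduct sub M = record
  { W = W M ; R = R M ; R-refl = R-refl M ; R-trans = R-trans M
  ; V = λ p h → V M p (sub p h)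
  ; V-mono = λ p h → V-mono M p (sub p h) }

record Iso {A : Set} {Θ : Voc A} (M N : Model Θ) : Set where
  field
    bij    : W M ↔ W N
  f : W M → W N
  f = Inverse.to bij
  field
    pres-R : ∀ u v → R M u v ⇔ R N (f u) (f v)
    pres-V : ∀ p (h : p ∈ᵥ Θ) u → V M p h u ⇔ V N p h (f u)
open Iso public using (bij; pres-R; pres-V) renaming (f to iso-map)

data IForm (A : Set) : Set where
  atom              : A → IForm A
  ⊥ᵢ ⊤ᵢ             : IForm A
  _∧ᵢ_ _∨ᵢ_ _⇒ᵢ_    : IForm A → IForm A → IForm A

data InVoc {A : Set} (Θ : Voc A) : IForm A → Set where
  atom : ∀ {p} → p ∈ᵥ Θ → InVoc Θ (atom p)
  ⊥ᵢ   : InVoc Θ ⊥ᵢ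
  ⊤ᵢ   : InVoc Θ ⊤ᵢ
  _∧ᵢ_ : ∀ {φ ψ} → InVoc Θ φ → InVoc Θ ψ → InVoc Θ (φ ∧ᵢ ψ)
  _∨ᵢ_ : ∀ {φ ψ} → InVoc Θ φ → InVoc Θ ψ → InVoc Θ (φ ∨ᵢ ψ)
  _⇒ᵢ_ : ∀ {φ ψ} → InVoc Θ φ → InVoc Θ ψ → InVoc Θ (φ ⇒ᵢ ψ)

_,_⊨IL_ : {A : Set} {Θ : Voc A} (M : Model Θ) → W M → {ψ : IForm A} → InVoc Θ ψ → Set
M , w ⊨IL atom {p} h = V M p h w
M , w ⊨IL ⊥ᵢ = ⊥
M , w ⊨IL ⊤ᵢ = ⊤
M , w ⊨IL (h ∧ᵢ k) = (M , w ⊨IL h) × (M , w ⊨IL k)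
M , w ⊨IL (h ∨ᵢ k) = (M , w ⊨IL h) ⊎ (M , w ⊨IL k)
M , w ⊨IL (h ⇒ᵢ k) = ∀ v → R M w v → M , v ⊨IL h → M , v ⊨IL k

ThIncl : {A : Set} {Θ : Voc A} (M₁ : Model Θ) → W M₁ → (M₂ : Model Θ) → W M₂ → Set
ThIncl {A} {Θ} M₁ w₁ M₂ w₂ = ∀ (ψ : IForm A) (h : InVoc Θ ψ) → M₁ , w₁ ⊨IL h → M₂ , w₂ ⊨IL h

-- Form is the collection of all formulas of the logic; L Θ is L(Θ).
-- sat M w φ is M,w ⊨_L φ; it is only meaningful (defined) when the
-- occurrence vocabulary occ φ is included in the vocabulary of M, and
-- every axiom only constrains it in that case.

record AIL (A : Set) : Set₁ where
  field
    Form : Set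
    L    : Voc A → Form → Set
    sat  : {Θ : Voc A} (M : Model Θ) → W M → Form → Set
    L-mono : ∀ {Θ Θ' φ} → Θ ⊆ᵥ Θ' → L Θ φ → L Θ' φ
    occ     : Form → Voc A
    occ-fin : ∀ φ → Finite (occ φ)
    occ-L   : ∀ {Θ φ} → L Θ φ → occ φ ⊆ᵥ Θ
    -- formulas satisfied (i.e. with ⊨ defined) on Θ-models lie in L(Θ)
    def-L   : ∀ {Θ φ} → occ φ ⊆ᵥ Θ → L Θ φ
    iso-inv : ∀ {Θ φ} → L Θ φ → {M N : Model Θ} (i : Iso M N) (w : W M)
              → sat M w φ ⇔ sat N (iso-map i w) φ
    expansion : ∀ {Θ Θ' φ} → L Θ φ → (sub : Θ ⊆ᵥ Θ') (M : Model Θ') (w : W M)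
              → sat M w φ ⇔ sat (reduct sub M) w φ
    _⇒ₗ_ _∧ₗ_ _∨ₗ_ : Form → Form → Form
    ⇒-L : ∀ {Θ φ ψ} → L Θ φ → L Θ ψ → L Θ (φ ⇒ₗ ψ)
    ∧-L : ∀ {Θ φ ψ} → L Θ φ → L Θ ψ → L Θ (φ ∧ₗ ψ)
    ∨-L : ∀ {Θ φ ψ} → L Θ φ → L Θ ψ → L Θ (φ ∨ₗ ψ)
    ⇒-sat : ∀ {Θ φ ψ} → L Θ φ → L Θ ψ → (M : Model Θ) (w : W M)
            → sat M w (φ ⇒ₗ ψ) ⇔ (∀ v → R M w v → sat M v φ → sat M v ψ)
    ∧-sat : ∀ {Θ φ ψ} → L Θ φ → L Θ ψ → (M : Model Θ) (w : W M)
            → sat M w (φ ∧ₗ ψ) ⇔ (sat M w φ × sat M w ψ)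
    ∨-sat : ∀ {Θ φ ψ} → L Θ φ → L Θ ψ → (M : Model Θ) (w : W M)
            → sat M w (φ ∨ₗ ψ) ⇔ (sat M w φ ⊎ sat M w ψ)
open AIL public

record ILsub {A : Set} (𝓛 : AIL A) : Set₁ where
  field
    emb     : IForm A → Form 𝓛
    emb-L   : ∀ {Θ ψ} → InVoc Θ ψ → L 𝓛 Θ (emb ψ)
    emb-occ : ∀ ψ → InVoc (occ 𝓛 (emb ψ)) ψ
    emb-sat : ∀ {Θ ψ} (h : InVoc Θ ψ) (M : Model Θ) (w : W M)
              → sat 𝓛 M w (emb ψ) ⇔ (M , w ⊨IL h)

_⊴IL : {A : Set} → AIL A → Set₁
_⊴IL {A} 𝓛 = ∀ (Θ : Voc A) (φ : Form 𝓛) → L 𝓛 Θ φ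
  → Σ (IForm A) λ ψ → Σ (InVoc Θ ψ) λ h
    → ∀ (M : Model Θ) (w : W M) → sat 𝓛 M w φ ⇔ (M , w ⊨IL h)

IsTheory : {A : Set} (𝓛 : AIL A) → Voc A → (Form 𝓛 → Set) → (Form 𝓛 → Set) → Set
IsTheory 𝓛 Θ Γ Δ = (∀ φ → Γ φ → L 𝓛 Θ φ) × (∀ φ → Δ φ → L 𝓛 Θ φ)

Satisfiable : {A : Set} (𝓛 : AIL A) → Voc A → (Form 𝓛 → Set) → (Form 𝓛 → Set) → Set₁
Satisfiable 𝓛 Θ Γ Δ = Σ (Model Θ) λ M → Σ (W M) λ w
  → (∀ φ → Γ φ → sat 𝓛 M w φ) × (∀ φ → Δ φ → ¬ sat 𝓛 M w φ)

FinSatisfiable : {A : Set} (𝓛 : AIL A) → Voc A → (Form 𝓛 → Set) → (Form 𝓛 → Set) → Set₁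
FinSatisfiable 𝓛 Θ Γ Δ = ∀ (Γ' Δ' : List (Form 𝓛)) → All Γ Γ' → All Δ Δ'
  → Σ (Model Θ) λ M → Σ (W M) λ w
    → All (sat 𝓛 M w) Γ' × All (λ φ → ¬ sat 𝓛 M w φ) Δ'

IntCompact : {A : Set} → AIL A → Set₁
IntCompact {A} 𝓛 = ∀ (Θ : Voc A) (Γ Δ : Form 𝓛 → Set) → IsTheory 𝓛 Θ Γ Δ
  → FinSatisfiable 𝓛 Θ Γ Δ → Satisfiable 𝓛 Θ Γ Δ

-- If every formula φ of 𝓛 were preserved under inclusion of positive IL theories, compactness
-- applied to {φ} against the IL formulas failing at a countermodel of φ would give one IL
-- consequence of φ (a finite disjunction) failing there. Compactness applied once more, to all
-- IL consequences of φ against φ itself, then gives a finite conjunction of them equivalent to φ,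
-- so 𝓛 ⊴ IL.
module Submission where

open import Defs
open import Level using (0ℓ; Lift; lift; lower) renaming (suc to lsuc)
open import Axiom.ExcludedMiddle using (ExcludedMiddle)
open import Axiom.DoubleNegationElimination using (em⇒dne)
open import Data.Product using (Σ; _×_; _,_)
open import Data.Product.Function.NonDependent.Propositional using (_×-⇔_)
open import Data.Sum using (inj₁; inj₂; [_,_])
open import Data.Sum.Function.Propositional using (_⊎-⇔_)
open import Data.Unit using (tt)
open import Data.List using (List; []; _∷_)
open import Data.List.Relation.Unary.All as All using (All; []; _∷_)
open import Function using (_∘_; id)
open import Function.Bundles using (_⇔_; mk⇔; Equivalence)
open import Relation.Nullary using (¬_)
open import Relation.Nullary.Decidable using (True; map′; toWitness; fromWitness)
open import Relation.Binary.PropositionalEquality using (_≡_; refl)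

open Equivalence using (to; from)

InVoc-mono : ∀ {A} {Θ Θ' : Voc A} {ψ} → Θ ⊆ᵥ Θ' → InVoc Θ ψ → InVoc Θ' ψ
InVoc-mono sub (atom p) = atom (sub _ p)
InVoc-mono sub ⊥ᵢ       = ⊥ᵢ
InVoc-mono sub ⊤ᵢ       = ⊤ᵢ
InVoc-mono sub (h ∧ᵢ k) = InVoc-mono sub h ∧ᵢ InVoc-mono sub k
InVoc-mono sub (h ∨ᵢ k) = InVoc-mono sub h ∨ᵢ InVoc-mono sub k
InVoc-mono sub (h ⇒ᵢ k) = InVoc-mono sub h ⇒ᵢ InVoc-mono sub k

⊨IL-reduct : ∀ {A} {Θ Θ' : Voc A} {ψ} (sub : Θ ⊆ᵥ Θ') (h : InVoc Θ ψ) (M : Model Θ') (w : W M)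
           → (reduct sub M , w ⊨IL h) ⇔ (M , w ⊨IL InVoc-mono sub h)
⊨IL-reduct sub (atom _) M w = mk⇔ id id
⊨IL-reduct sub ⊥ᵢ       M w = mk⇔ id id
⊨IL-reduct sub ⊤ᵢ       M w = mk⇔ id id
⊨IL-reduct sub (h ∧ᵢ k) M w = ⊨IL-reduct sub h M w ×-⇔ ⊨IL-reduct sub k M w
⊨IL-reduct sub (h ∨ᵢ k) M w = ⊨IL-reduct sub h M w ⊎-⇔ ⊨IL-reduct sub k M w
⊨IL-reduct sub (h ⇒ᵢ k) M w = mk⇔
  (λ f v r → to (⊨IL-reduct sub k M v) ∘ f v r ∘ from (⊨IL-reduct sub h M v))
  (λ f v r → from (⊨IL-reduct sub k M v) ∘ f v r ∘ to (⊨IL-reduct sub h M v))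

ThIncl-reduct : ∀ {A} {Θ Θ' : Voc A} (sub : Θ ⊆ᵥ Θ') {M₁ : Model Θ'} {w₁ : W M₁} {M₂ : Model Θ'} {w₂ : W M₂}
              → ThIncl M₁ w₁ M₂ w₂ → ThIncl (reduct sub M₁) w₁ (reduct sub M₂) w₂
ThIncl-reduct sub {M₁} {w₁} {M₂} {w₂} incl ψ h =
  from (⊨IL-reduct sub h M₂ w₂) ∘ incl ψ (InVoc-mono sub h) ∘ to (⊨IL-reduct sub h M₁ w₁)

module Classical (em : ExcludedMiddle (lsuc 0ℓ)) where

  dne₁ : {P : Set₁} → ¬ ¬ P → P
  dne₁ = em⇒dne em

  dne₀ : {P : Set} → ¬ ¬ P → P
  dne₀ = em⇒dne (λ {P} → map′ lower lift (em {Lift (lsuc 0ℓ) P}))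

  -- Theories of 𝓛 are Set-valued, while many natural conditions on formulas quantify over models.
  Resize : Set₁ → Set
  Resize P = True (em {P})

module _ {A : Set} (𝓛 : AIL A) where

  Preserved : Voc A → Form 𝓛 → Set₁
  Preserved Θ φ = ∀ (M₁ : Model Θ) w₁ (M₂ : Model Θ) w₂
                → ThIncl M₁ w₁ M₂ w₂ → sat 𝓛 M₁ w₁ φ → sat 𝓛 M₂ w₂ φ

  ILDefinable : Voc A → Form 𝓛 → Set₁
  ILDefinable Θ φ = Σ (IForm A) λ ψ → Σ (InVoc Θ ψ) λ h
                  → ∀ (M : Model Θ) w → sat 𝓛 M w φ ⇔ (M , w ⊨IL h)

  L-occ : ∀ φ → L 𝓛 (occ 𝓛 φ) φ
  L-occ φ = def-L 𝓛 (λ _ → id)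

  Preserved-occ⇒Preserved : ∀ {Θ φ} → L 𝓛 Θ φ → Preserved (occ 𝓛 φ) φ → Preserved Θ φ
  Preserved-occ⇒Preserved {φ = φ} lφ pres M₁ w₁ M₂ w₂ incl =
      from (expansion 𝓛 (L-occ φ) sub M₂ w₂)
    ∘ pres (reduct sub M₁) w₁ (reduct sub M₂) w₂ (ThIncl-reduct sub incl)
    ∘ to (expansion 𝓛 (L-occ φ) sub M₁ w₁)
    where sub = occ-L 𝓛 lφ

  record FiniteRefutation (Θ : Voc A) (Γ Δ : Form 𝓛 → Set) : Set₁ where
    field
      Γ₀ Δ₀   : List (Form 𝓛)
      Γ₀⊆Γ    : All Γ Γ₀
      Δ₀⊆Δ    : All Δ Δ₀
      refutes : ∀ (M : Model Θ) w → All (sat 𝓛 M w) Γ₀ → ¬ All (λ χ → ¬ sat 𝓛 M w χ) Δ₀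

  module _ (em : ExcludedMiddle (lsuc 0ℓ)) (compact : IntCompact 𝓛) where
    open Classical em

    unsatisfiable⇒refutable : ∀ {Θ Γ Δ} → IsTheory 𝓛 Θ Γ Δ → ¬ Satisfiable 𝓛 Θ Γ Δ
                            → FiniteRefutation Θ Γ Δ
    unsatisfiable⇒refutable {Θ} {Γ} {Δ} th unsat = dne₁ λ ¬ref →
      unsat (compact Θ Γ Δ th λ Γ₀ Δ₀ Γ₀⊆Γ Δ₀⊆Δ → dne₁ λ ¬model →
        ¬ref (record { Γ₀ = Γ₀ ; Δ₀ = Δ₀ ; Γ₀⊆Γ = Γ₀⊆Γ ; Δ₀⊆Δ = Δ₀⊆Δ
                     ; refutes = λ M w g d → ¬model (M , w , g , d) }))

module _ {A : Set} {𝓛 : AIL A} (il : ILsub 𝓛) {Θ : Voc A} where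
  open ILsub il

  ILImage : ((ψ : IForm A) → InVoc Θ ψ → Set) → Form 𝓛 → Set
  ILImage P χ = Σ (IForm A) λ ψ → Σ (InVoc Θ ψ) λ h → emb ψ ≡ χ × P ψ h

  ILImage-L : ∀ {P χ} → ILImage P χ → L 𝓛 Θ χ
  ILImage-L (_ , h , refl , _) = emb-L h

  module _ {P : (ψ : IForm A) → InVoc Θ ψ → Set} where

    ⋀ᵢ ⋁ᵢ : ∀ {xs} → All (ILImage P) xs → IForm A
    ⋀ᵢ []            = ⊤ᵢ
    ⋀ᵢ ((ψ , _) ∷ a) = ψ ∧ᵢ ⋀ᵢ a
    ⋁ᵢ []            = ⊥ᵢ
    ⋁ᵢ ((ψ , _) ∷ a) = ψ ∨ᵢ ⋁ᵢ a

    ⋀ᵢ-InVoc : ∀ {xs} (a : All (ILImage P) xs) → InVoc Θ (⋀ᵢ a)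
    ⋀ᵢ-InVoc []                = ⊤ᵢ
    ⋀ᵢ-InVoc ((_ , h , _) ∷ a) = h ∧ᵢ ⋀ᵢ-InVoc a

    ⋁ᵢ-InVoc : ∀ {xs} (a : All (ILImage P) xs) → InVoc Θ (⋁ᵢ a)
    ⋁ᵢ-InVoc []                = ⊥ᵢ
    ⋁ᵢ-InVoc ((_ , h , _) ∷ a) = h ∨ᵢ ⋁ᵢ-InVoc a

    ⊨⋀ᵢ⇔All : (M : Model Θ) (w : W M) {xs : List (Form 𝓛)} (a : All (ILImage P) xs)
            → (M , w ⊨IL ⋀ᵢ-InVoc a) ⇔ All (sat 𝓛 M w) xs
    ⊨⋀ᵢ⇔All M w []                     = mk⇔ (λ _ → []) (λ _ → tt)
    ⊨⋀ᵢ⇔All M w ((_ , h , refl , _) ∷ a) = mk⇔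
      (λ (s , t) → from (emb-sat h M w) s ∷ to (⊨⋀ᵢ⇔All M w a) t)
      (λ { (s ∷ t) → to (emb-sat h M w) s , from (⊨⋀ᵢ⇔All M w a) t })

    ⊭⋁ᵢ⇔All : (M : Model Θ) (w : W M) {xs : List (Form 𝓛)} (a : All (ILImage P) xs)
            → (¬ M , w ⊨IL ⋁ᵢ-InVoc a) ⇔ All (λ χ → ¬ sat 𝓛 M w χ) xs
    ⊭⋁ᵢ⇔All M w []                     = mk⇔ (λ _ → []) (λ _ ())
    ⊭⋁ᵢ⇔All M w ((_ , h , refl , _) ∷ a) = mk⇔
      (λ n → n ∘ inj₁ ∘ to (emb-sat h M w) ∷ to (⊭⋁ᵢ⇔All M w a) (n ∘ inj₂))
      (λ { (n ∷ ns) → [ n ∘ from (emb-sat h M w) , from (⊭⋁ᵢ⇔All M w a) ns ] })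

module _ (em : ExcludedMiddle (lsuc 0ℓ)) {A : Set} {𝓛 : AIL A} (compact : IntCompact 𝓛) (il : ILsub 𝓛)
         {Θ : Voc A} {φ : Form 𝓛} (lφ : L 𝓛 Θ φ) where
  open Classical em
  open ILsub il

  Entails : (ψ : IForm A) → InVoc Θ ψ → Set₁
  Entails ψ h = ∀ (M : Model Θ) w → sat 𝓛 M w φ → M , w ⊨IL h

  private
    ≡φ-L : ∀ {χ} → χ ≡ φ → L 𝓛 Θ χ
    ≡φ-L refl = lφ

  separatingConsequence : Preserved 𝓛 Θ φ → ∀ (M₂ : Model Θ) w₂ → ¬ sat 𝓛 M₂ w₂ φ
                        → Σ (IForm A) λ ψ → Σ (InVoc Θ ψ) λ h → Entails ψ h × ¬ (M₂ , w₂ ⊨IL h)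
  separatingConsequence pres M₂ w₂ ¬φ = ⋁ᵢ il Δ₀⊆Δ , ⋁ᵢ-InVoc il Δ₀⊆Δ , entails , fails
    where
      FailsAtw₂ : (ψ : IForm A) → InVoc Θ ψ → Set
      FailsAtw₂ ψ h = ¬ (M₂ , w₂ ⊨IL h)

      unsat : ¬ Satisfiable 𝓛 Θ (_≡ φ) (ILImage il FailsAtw₂)
      unsat (M₁ , w₁ , g , d) = ¬φ (pres M₁ w₁ M₂ w₂ incl (g φ refl))
        where
          incl : ThIncl M₁ w₁ M₂ w₂
          incl ψ h s = dne₀ λ n → d (emb ψ) (ψ , h , refl , n) (from (emb-sat h M₁ w₁) s)

      open FiniteRefutation (unsatisfiable⇒refutable 𝓛 em compact ((λ _ → ≡φ-L) , (λ _ → ILImage-L il)) unsat)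

      entails : Entails (⋁ᵢ il Δ₀⊆Δ) (⋁ᵢ-InVoc il Δ₀⊆Δ)
      entails M w s = dne₀ λ n → refutes M w (All.map (λ { refl → s }) Γ₀⊆Γ) (to (⊭⋁ᵢ⇔All il M w Δ₀⊆Δ) n)

      fails : ¬ (M₂ , w₂ ⊨IL ⋁ᵢ-InVoc il Δ₀⊆Δ)
      fails = from (⊭⋁ᵢ⇔All il M₂ w₂ Δ₀⊆Δ)
                   (All.map (λ { (_ , h , refl , n) → n ∘ to (emb-sat h M₂ w₂) }) Δ₀⊆Δ)

  Preserved⇒ILDefinable : Preserved 𝓛 Θ φ → ILDefinable 𝓛 Θ φ
  Preserved⇒ILDefinable pres = ⋀ᵢ il Γ₀⊆Γ , ⋀ᵢ-InVoc il Γ₀⊆Γ , λ M w → mk⇔ (conjuncts M w) (φ-from-conjuncts M w)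
    where
      Consequence : (ψ : IForm A) → InVoc Θ ψ → Set
      Consequence ψ h = Resize (Entails ψ h)

      unsat : ¬ Satisfiable 𝓛 Θ (ILImage il Consequence) (_≡ φ)
      unsat (M , w , g , d) =
        let ψ , h , ent , fails = separatingConsequence pres M w (d φ refl)
        in fails (to (emb-sat h M w) (g (emb ψ) (ψ , h , refl , fromWitness ent)))

      open FiniteRefutation (unsatisfiable⇒refutable 𝓛 em compact ((λ _ → ILImage-L il) , (λ _ → ≡φ-L)) unsat)

      conjuncts : ∀ (M : Model Θ) w → sat 𝓛 M w φ → M , w ⊨IL ⋀ᵢ-InVoc il Γ₀⊆Γ
      conjuncts M w s = from (⊨⋀ᵢ⇔All il M w Γ₀⊆Γ)
        (All.map (λ { (_ , h , refl , c) → from (emb-sat h M w) (toWitness c M w s) }) Γ₀⊆Γ)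

      φ-from-conjuncts : ∀ (M : Model Θ) w → M , w ⊨IL ⋀ᵢ-InVoc il Γ₀⊆Γ → sat 𝓛 M w φ
      φ-from-conjuncts M w t = dne₀ λ ¬s →
        refutes M w (to (⊨⋀ᵢ⇔All il M w Γ₀⊆Γ) t) (All.map (λ { refl → ¬s }) Δ₀⊆Δ)

proposition5p1 : ExcludedMiddle (Level.suc 0ℓ) → {A : Set} (𝓛 : AIL A) → IntCompact 𝓛 → ILsub 𝓛 → ¬ (𝓛 ⊴IL)
    → Σ (Form 𝓛) λ φ → L 𝓛 (occ 𝓛 φ) φ
      × Σ (Model (occ 𝓛 φ)) λ M₁ → Σ (W M₁) λ w₁ → Σ (Model (occ 𝓛 φ)) λ M₂ → Σ (W M₂) λ w₂
        → ThIncl M₁ w₁ M₂ w₂ × sat 𝓛 M₁ w₁ φ × ¬ sat 𝓛 M₂ w₂ φ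
proposition5p1 em 𝓛 compact il ¬⊴IL = dne₁ λ noCounterexample →
  ¬⊴IL λ Θ φ lφ → Preserved⇒ILDefinable em compact il lφ
    (Preserved-occ⇒Preserved 𝓛 lφ λ M₁ w₁ M₂ w₂ incl s →
      dne₀ λ ¬s → noCounterexample (φ , L-occ 𝓛 φ , M₁ , w₁ , M₂ , w₂ , incl , s , ¬s))
  where open Classical em
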